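{- Let $q$ be a prime power, $r,n$ positive integers with $rn$ even, $V$ an $r$-dimensional $\mathbb{F}_{q^n}$-vector space, and $U$ an $\mathbb{F}_q$-subspace of $V$ with $\dim_{\mathbb{F}_q}U=rn/2$ such that $\max\{\dim_{\mathbb{F}_q}(U\cap\langle v\rangle_{\mathbb{F}_{q^n}}): v\in V\}<n$. Let $W$ be an $\mathbb{F}_q$-space of dimension $rn/2$ and let $G,\overline{G}:V\to W$ be $\mathbb{F}_q$-linear maps with $\ker G=\ker\overline{G}=U$. For $v\in V$ let $\tau_v:\mathbb{F}_{q^n}\to V$, $\lambda\mapsto\lambda v$, and put $\mathcal{C}_{U,G}=\{G\circ\tau_v:v\in V\}$ and $\mathcal{C}_{U,\overline{G}}=\{\overline{G}\circ\tau_v:v\in V\}$. Then $\mathcal{C}_{U,G}$ and $\mathcal{C}_{U,\overline{G}}$ are equivalent.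
   Context: Two sets $\mathcal{C},\mathcal{C}'$ of $\mathbb{F}_q$-linear maps from an $\mathbb{F}_q$-space $X$ to an $\mathbb{F}_q$-space $Y$ are equivalent if there exist invertible $\mathbb{F}_q$-linear maps $L_1\in\mathrm{GL}(Y,\mathbb{F}_q)$, $L_2\in\mathrm{GL}(X,\mathbb{F}_q)$ and $\rho\in\mathrm{Aut}(\mathbb{F}_q)$ such that $\mathcal{C}'=\{L_1\circ f^{\rho}\circ L_2 : f\in\mathcal{C}\}$, where $f^\rho(x)=f(x^{\rho^{ -1}})^{\rho}$. Here $X=\mathbb{F}_{q^n}$ and $Y=W$. -}

module Defs where

open import Level using (0ℓ) renaming (suc to lsuc)
open import Data.Nat using (ℕ; zero; suc; _≤_; _^_)
open import Data.Nat.Primality using (Prime)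
open import Data.Fin using (Fin; zero; suc)
open import Data.Product using (Σ; ∃; ∃-syntax; _×_; _,_; proj₁)
open import Data.Unit using (⊤; tt)
open import Relation.Nullary using (¬_)
open import Relation.Binary.PropositionalEquality using (_≡_)
open import Function using (_∘_)
open import Algebra.Bundles using (CommutativeRing)
open import Algebra.Module.Bundles using (Module)
import Algebra.Morphism.Structures as MS

IsField : CommutativeRing 0ℓ 0ℓ → Set
IsField F = (¬ (1# ≈ 0#)) × (∀ x → ¬ (x ≈ 0#) → ∃[ y ] (x * y ≈ 1#))
  where open CommutativeRing F

HasCard : CommutativeRing 0ℓ 0ℓ → ℕ → Set
HasCard F q = Σ (Fin q → Carrier) λ e →
  (∀ i j → e i ≈ e j → i ≡ j) × (∀ x → ∃[ i ] (e i ≈ x))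
  where open CommutativeRing F

PrimePower : ℕ → Set
PrimePower q = ∃[ p ] ∃[ k ] (Prime p × 1 ≤ k × q ≡ p ^ k)

IsRingHom : (F K : CommutativeRing 0ℓ 0ℓ) →
            (CommutativeRing.Carrier F → CommutativeRing.Carrier K) → Set
IsRingHom F K f =
  MS.RingMorphisms.IsRingHomomorphism (CommutativeRing.rawRing F) (CommutativeRing.rawRing K) f

record Aut (F : CommutativeRing 0ℓ 0ℓ) : Set where
  open CommutativeRing F
  field
    ρ      : Carrier → Carrier
    ρ⁻¹    : Carrier → Carrier
    isHom  : IsRingHom F F ρ
    invˡ   : ∀ x → ρ⁻¹ (ρ x) ≈ x
    invʳ   : ∀ x → ρ (ρ⁻¹ x) ≈ x

-- F-spaces given by their raw operations (used for restriction of scalars)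

record Act (F : CommutativeRing 0ℓ 0ℓ) : Set₁ where
  field
    Carrier : Set
    _≈_     : Carrier → Carrier → Set
    _+_     : Carrier → Carrier → Carrier
    0v      : Carrier
    _·_     : CommutativeRing.Carrier F → Carrier → Carrier

modAct : {F : CommutativeRing 0ℓ 0ℓ} → Module F 0ℓ 0ℓ → Act F
modAct M = record
  { Carrier = Carrierᴹ ; _≈_ = _≈ᴹ_ ; _+_ = _+ᴹ_ ; 0v = 0ᴹ ; _·_ = _*ₗ_ }
  where open Module M

selfAct : (K : CommutativeRing 0ℓ 0ℓ) → Act K
selfAct K = record { Carrier = Carrier ; _≈_ = _≈_ ; _+_ = _+_ ; 0v = 0# ; _·_ = _*_ }
  where open CommutativeRing K

restrict : {F K : CommutativeRing 0ℓ 0ℓ} →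
           (CommutativeRing.Carrier F → CommutativeRing.Carrier K) → Act K → Act F
restrict ι A = record
  { Carrier = Carrier ; _≈_ = _≈_ ; _+_ = _+_ ; 0v = 0v ; _·_ = λ a v → ι a · v }
  where open Act A

module _ {F : CommutativeRing 0ℓ 0ℓ} (A : Act F) where
  open Act A
  private module F = CommutativeRing F

  lincomb : {d : ℕ} → (Fin d → F.Carrier) → (Fin d → Carrier) → Carrier
  lincomb {zero}  c b = 0v
  lincomb {suc d} c b = (c zero · b zero) + lincomb (c ∘ suc) (b ∘ suc)

  record Subspace (S : Carrier → Set) : Set where
    field
      resp  : ∀ {u v} → u ≈ v → S u → S v
      has0  : S 0v
      +-cl  : ∀ {u v} → S u → S v → S (u + v)
      ·-cl  : ∀ a {u} → S u → S (a · u)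

  record Basis (S : Carrier → Set) (d : ℕ) : Set where
    field
      vec   : Fin d → Carrier
      inS   : ∀ i → S (vec i)
      indep : ∀ c → lincomb c vec ≈ 0v → ∀ i → c i F.≈ F.0#
      span  : ∀ v → S v → Σ (Fin d → F.Carrier) λ c → v ≈ lincomb c vec

  HasDim : (Carrier → Set) → ℕ → Set
  HasDim S d = Basis S d

  Full : Carrier → Set
  Full _ = ⊤

  -- x ↦ x^σ : apply σ to the coordinates of x with respect to a basis
  twist : {d : ℕ} → Basis Full d → (F.Carrier → F.Carrier) → Carrier → Carrier
  twist b σ x = lincomb (σ ∘ proj₁ (Basis.span b x tt)) (Basis.vec b)

module _ {F : CommutativeRing 0ℓ 0ℓ} (A B : Act F) where
  private
    module A = Act A
    module B = Act B

  record Linear (f : A.Carrier → B.Carrier) : Set where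
    field
      cong  : ∀ {u v} → u A.≈ v → f u B.≈ f v
      +-hom : ∀ u v → f (u A.+ v) B.≈ (f u B.+ f v)
      ·-hom : ∀ a u → f (a A.· u) B.≈ (a B.· f u)

record GL {F : CommutativeRing 0ℓ 0ℓ} (A : Act F) : Set where
  open Act A
  field
    fun    : Carrier → Carrier
    linear : Linear A A fun
    inv    : Carrier → Carrier
    invˡ   : ∀ x → inv (fun x) ≈ x
    invʳ   : ∀ x → fun (inv x) ≈ x

-- Equivalence of two sets of F-linear maps X → Y (sets given as predicates on
-- functions, membership up to pointwise equality):
-- C' = { L₁ ∘ f^ρ ∘ L₂ : f ∈ C },  f^ρ(x) = f(x^{ρ⁻¹})^ρ, where x^ρ is taken
-- coordinatewise with respect to (some) fixed F-bases of X and Y.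
Equivalent : {F : CommutativeRing 0ℓ 0ℓ} (X Y : Act F) →
             ((Act.Carrier X → Act.Carrier Y) → Set) →
             ((Act.Carrier X → Act.Carrier Y) → Set) → Set
Equivalent {F} X Y C C' =
  Σ ℕ λ dX → Σ (Basis X (Full X) dX) λ bX →
  Σ ℕ λ dY → Σ (Basis Y (Full Y) dY) λ bY →
  Σ (Aut F) λ σ → Σ (GL Y) λ L₁ → Σ (GL X) λ L₂ →
  let image : (Act.Carrier X → Act.Carrier Y) → (Act.Carrier X → Act.Carrier Y)
      image f x = GL.fun L₁ (twist Y bY (Aut.ρ σ) (f (twist X bX (Aut.ρ⁻¹ σ) (GL.fun L₂ x))))
  in ∀ g → (C' g → ∃[ f ] (C f × ∀ x → Act._≈_ Y (g x) (image f x)))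
         × ((∃[ f ] (C f × ∀ x → Act._≈_ Y (g x) (image f x))) → C' g)

CodeSet : {Fq K : CommutativeRing 0ℓ 0ℓ} (V : Module K 0ℓ 0ℓ) (W : Module Fq 0ℓ 0ℓ) →
          (Module.Carrierᴹ V → Module.Carrierᴹ W) →
          (CommutativeRing.Carrier K → Module.Carrierᴹ W) → Set
CodeSet V W G g = ∃[ v ] (∀ μ → Module._≈ᴹ_ W (g μ) (G (Module._*ₗ_ V μ v)))

module Submission where

-- Since ker G = ker G̅, there is an automorphism L of W with L ∘ G = G̅: pick x₁ … x_k in V
-- such that the G xᵢ form a basis of im G.  Then the G̅ xᵢ are independent as well, both
-- families extend to bases of W of the same length (Steinitz exchange), and the
-- change-of-basis automorphism L sends G xᵢ to G̅ xᵢ.  For any v, writing G v = Σ aᵢ G xᵢ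
-- puts v − Σ aᵢ xᵢ in the common kernel, so L (G v) = Σ aᵢ G̅ xᵢ = G̅ v.  Hence
-- L ∘ G ∘ τ_v = G̅ ∘ τ_v, and (ρ, L₁, L₂) = (id, L, id) witnesses the equivalence.
-- Finiteness of 𝔽_q makes every choice constructive: membership in a span is decided by
-- running through all coefficient vectors.

open import Defs
open import Level using (0ℓ)
open import Data.Nat as ℕ using (ℕ; zero; suc; _≤_; _<_; _*_; _^_; z≤n; s≤s)
import Data.Nat.Properties as ℕ
open import Data.Fin as Fin using (Fin; zero; suc; _↑ʳ_; punchIn; combine; remQuot)
open import Data.Fin.Properties using (any?; all?; remQuot-combine)
open import Data.Vec.Functional using (_∷_; head; tail; insertAt; removeAt)
open import Data.Vec.Functional.Properties using (insertAt-punchIn)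
open import Data.Product using (Σ; ∃-syntax; _×_; _,_; proj₁; proj₂)
open import Data.Unit using (tt)
open import Data.Empty using (⊥-elim)
open import Relation.Nullary using (¬_; Dec; yes; no)
open import Relation.Nullary.Decidable using (¬?; decidable-stable; map′)
open import Relation.Binary.Definitions using (Decidable)
open import Relation.Binary.PropositionalEquality as ≡ using (_≡_)
open import Function using (_∘_; id)
open import Function.Bundles using (_⇔_; Equivalence)
open import Algebra.Bundles using (CommutativeRing; CommutativeMonoid)
open import Algebra.Module.Bundles using (Module)
open import Algebra.Module.Structures.Biased using (IsModuleFromLeft)
open import Algebra.Module.Construct.TensorUnit using (⟨module⟩)
open import Algebra.Morphism.Construct.Identity using (isRingHomomorphism)
import Algebra.Morphism.Structures as MS
import Function.Properties.Equivalence as ⇔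
import Algebra.Properties.AbelianGroup as AbelianGroupProperties
import Algebra.Properties.CommutativeSemigroup as CommutativeSemigroupProperties
import Relation.Binary.Reasoning.Setoid as SetoidReasoning

-- modAct (restrictScalars ι ι-hom V) is definitionally restrict ι (modAct V), so results about
-- modules apply verbatim to the restricted spaces appearing in the statement.
restrictScalars : {F K : CommutativeRing 0ℓ 0ℓ}
                  (ι : CommutativeRing.Carrier F → CommutativeRing.Carrier K) → IsRingHom F K ι →
                  Module K 0ℓ 0ℓ → Module F 0ℓ 0ℓ
restrictScalars {F} ι ι-hom V = record
  { Carrierᴹ = Carrierᴹ
  ; _≈ᴹ_ = _≈ᴹ_
  ; _+ᴹ_ = _+ᴹ_
  ; _*ₗ_ = λ a v → ι a *ₗ v
  ; _*ᵣ_ = λ v a → ι a *ₗ v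
  ; 0ᴹ = 0ᴹ
  ; -ᴹ_ = -ᴹ_
  ; isModule = IsModuleFromLeft.isModule {commutativeRing = F} (record { isLeftModule = record
    { isLeftSemimodule = record
      { +ᴹ-isCommutativeMonoid = +ᴹ-isCommutativeMonoid
      ; isPreleftSemimodule = record
        { *ₗ-cong = λ a≈b u≈v → *ₗ-cong (⟦⟧-cong a≈b) u≈v
        ; *ₗ-zeroˡ = λ u → ≈ᴹ-trans (*ₗ-cong 0#-homo ≈ᴹ-refl) (*ₗ-zeroˡ u)
        ; *ₗ-distribʳ = λ u a b → ≈ᴹ-trans (*ₗ-cong (+-homo a b) ≈ᴹ-refl) (*ₗ-distribʳ u (ι a) (ι b))
        ; *ₗ-identityˡ = λ u → ≈ᴹ-trans (*ₗ-cong 1#-homo ≈ᴹ-refl) (*ₗ-identityˡ u)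
        ; *ₗ-assoc = λ a b u → ≈ᴹ-trans (*ₗ-cong (*-homo a b) ≈ᴹ-refl) (*ₗ-assoc (ι a) (ι b) u)
        ; *ₗ-zeroʳ = λ a → *ₗ-zeroʳ (ι a)
        ; *ₗ-distribˡ = λ a → *ₗ-distribˡ (ι a)
        }
      }
    ; -ᴹ‿cong = -ᴹ‿cong
    ; -ᴹ‿inverse = -ᴹ‿inverse
    } })
  }
  where open Module V
        open MS.RingMorphisms.IsRingHomomorphism ι-hom using (⟦⟧-cong; 0#-homo; 1#-homo; +-homo; *-homo)

enumeration⇒≈-dec : (K : CommutativeRing 0ℓ 0ℓ) {N : ℕ} → HasCard K N → Decidable (CommutativeRing._≈_ K)
enumeration⇒≈-dec K (e , injective , surjective) x y = map′
  (λ i≡j → trans (sym eᵢ≈x) (trans (reflexive (≡.cong e i≡j)) eⱼ≈y))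
  (λ x≈y → injective i j (trans eᵢ≈x (trans x≈y (sym eⱼ≈y))))
  (i Fin.≟ j)
  where
  open CommutativeRing K
  open Σ (surjective x) renaming (proj₁ to i; proj₂ to eᵢ≈x)
  open Σ (surjective y) renaming (proj₁ to j; proj₂ to eⱼ≈y)

infixr 5 _++_

-- Unlike Data.Vec.Functional._++_, this unfolds along the first family, so that
-- (x ∷ a) ++ u is definitionally x ∷ (a ++ u).
_++_ : ∀ {a} {A : Set a} {j k} → (Fin j → A) → (Fin k → A) → Fin (j ℕ.+ k) → A
_++_ {j = zero}  a u = u
_++_ {j = suc j} a u = head a ∷ (tail a ++ u)

++-↑ʳ : ∀ {a} {A : Set a} {j k} (a : Fin j → A) (u : Fin k → A) i → (a ++ u) (j ↑ʳ i) ≡ u i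
++-↑ʳ {j = zero}  a u i = ≡.refl
++-↑ʳ {j = suc j} a u i = ++-↑ʳ (tail a) u i

module LinearCombinations {F : CommutativeRing 0ℓ 0ℓ} (M : Module F 0ℓ 0ℓ) where
  private module F = CommutativeRing F
  open Module M
  open AbelianGroupProperties +ᴹ-abelianGroup
    using (inverseˡ-unique; ⁻¹-∙-comm; xyx⁻¹≈y)
  open CommutativeSemigroupProperties (CommutativeMonoid.commutativeSemigroup +ᴹ-commutativeMonoid) using (interchange; x∙yz≈y∙xz)
  open SetoidReasoning ≈ᴹ-setoid

  A : Act F
  A = modAct M

  unitVector : ∀ {d} → Fin d → Fin d → F.Carrier
  unitVector zero    = F.1# ∷ λ _ → F.0#
  unitVector (suc t) = F.0# ∷ unitVector t

  Span : ∀ {d} → (Fin d → Carrierᴹ) → Carrierᴹ → Set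
  Span b w = Σ _ λ c → w ≈ᴹ lincomb A c b

  Independent : ∀ {d} → (Fin d → Carrierᴹ) → Set
  Independent b = ∀ c → lincomb A c b ≈ᴹ 0ᴹ → ∀ i → c i F.≈ F.0#

  -‿*ₗ : ∀ a u → (F.- a) *ₗ u ≈ᴹ -ᴹ (a *ₗ u)
  -‿*ₗ a u = inverseˡ-unique _ _ (begin
    (F.- a) *ₗ u +ᴹ a *ₗ u ≈⟨ ≈ᴹ-sym (*ₗ-distribʳ u (F.- a) a) ⟩
    (F.- a F.+ a) *ₗ u     ≈⟨ *ₗ-cong (F.-‿inverseˡ a) ≈ᴹ-refl ⟩
    F.0# *ₗ u              ≈⟨ *ₗ-zeroˡ u ⟩
    0ᴹ                     ∎)

  *ₗ-‿ : ∀ a u → a *ₗ (-ᴹ u) ≈ᴹ -ᴹ (a *ₗ u)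
  *ₗ-‿ a u = inverseˡ-unique _ _ (begin
    a *ₗ (-ᴹ u) +ᴹ a *ₗ u ≈⟨ *ₗ-distribˡ a (-ᴹ u) u ⟨
    a *ₗ (-ᴹ u +ᴹ u)      ≈⟨ *ₗ-cong F.refl (-ᴹ‿inverseˡ u) ⟩
    a *ₗ 0ᴹ               ≈⟨ *ₗ-zeroʳ a ⟩
    0ᴹ                    ∎)

  +ᴹ-‿-cancelˡ : ∀ a x y → (a +ᴹ x) +ᴹ -ᴹ (a +ᴹ y) ≈ᴹ x +ᴹ -ᴹ y
  +ᴹ-‿-cancelˡ a x y = begin
    (a +ᴹ x) +ᴹ -ᴹ (a +ᴹ y)        ≈⟨ +ᴹ-cong ≈ᴹ-refl (⁻¹-∙-comm a y) ⟨
    (a +ᴹ x) +ᴹ (-ᴹ a +ᴹ -ᴹ y)     ≈⟨ interchange a x (-ᴹ a) (-ᴹ y) ⟩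
    (a +ᴹ -ᴹ a) +ᴹ (x +ᴹ -ᴹ y)     ≈⟨ +ᴹ-cong (-ᴹ‿inverseʳ a) ≈ᴹ-refl ⟩
    0ᴹ +ᴹ (x +ᴹ -ᴹ y)              ≈⟨ +ᴹ-identityˡ _ ⟩
    x +ᴹ -ᴹ y                      ∎

  lincomb-cong : ∀ {d} {c c' : Fin d → F.Carrier} {b b'} →
                 (∀ i → c i F.≈ c' i) → (∀ i → b i ≈ᴹ b' i) → lincomb A c b ≈ᴹ lincomb A c' b'
  lincomb-cong {zero}  c≈c' b≈b' = ≈ᴹ-refl
  lincomb-cong {suc d} c≈c' b≈b' =
    +ᴹ-cong (*ₗ-cong (c≈c' zero) (b≈b' zero)) (lincomb-cong (c≈c' ∘ suc) (b≈b' ∘ suc))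

  lincomb-0# : ∀ {d} {c : Fin d → F.Carrier} b → (∀ i → c i F.≈ F.0#) → lincomb A c b ≈ᴹ 0ᴹ
  lincomb-0# {zero}  b c≈0 = ≈ᴹ-refl
  lincomb-0# {suc d} b c≈0 = ≈ᴹ-trans
    (+ᴹ-cong (≈ᴹ-trans (*ₗ-cong (c≈0 zero) ≈ᴹ-refl) (*ₗ-zeroˡ _)) (lincomb-0# (tail b) (c≈0 ∘ suc)))
    (+ᴹ-identityˡ 0ᴹ)

  lincomb-+ : ∀ {d} (c c' : Fin d → F.Carrier) b →
              lincomb A (λ i → c i F.+ c' i) b ≈ᴹ lincomb A c b +ᴹ lincomb A c' b
  lincomb-+ {zero}  c c' b = ≈ᴹ-sym (+ᴹ-identityˡ 0ᴹ)
  lincomb-+ {suc d} c c' b = ≈ᴹ-trans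
    (+ᴹ-cong (*ₗ-distribʳ (b zero) (c zero) (c' zero)) (lincomb-+ (tail c) (tail c') (tail b)))
    (interchange _ _ _ _)

  lincomb-+ᴹ : ∀ {d} c (b b' : Fin d → Carrierᴹ) →
               lincomb A c (λ i → b i +ᴹ b' i) ≈ᴹ lincomb A c b +ᴹ lincomb A c b'
  lincomb-+ᴹ {zero}  c b b' = ≈ᴹ-sym (+ᴹ-identityˡ 0ᴹ)
  lincomb-+ᴹ {suc d} c b b' = ≈ᴹ-trans
    (+ᴹ-cong (*ₗ-distribˡ (c zero) (b zero) (b' zero)) (lincomb-+ᴹ (tail c) (tail b) (tail b')))
    (interchange _ _ _ _)

  lincomb-* : ∀ {d} a (c : Fin d → F.Carrier) b → lincomb A (λ i → a F.* c i) b ≈ᴹ a *ₗ lincomb A c b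
  lincomb-* {zero}  a c b = ≈ᴹ-sym (*ₗ-zeroʳ a)
  lincomb-* {suc d} a c b = ≈ᴹ-trans
    (+ᴹ-cong (*ₗ-assoc a (c zero) (b zero)) (lincomb-* a (tail c) (tail b)))
    (≈ᴹ-sym (*ₗ-distribˡ a _ _))

  lincomb-neg : ∀ {d} (c : Fin d → F.Carrier) b → lincomb A (λ i → F.- c i) b ≈ᴹ -ᴹ lincomb A c b
  lincomb-neg {zero}  c b = inverseˡ-unique 0ᴹ 0ᴹ (+ᴹ-identityˡ 0ᴹ)
  lincomb-neg {suc d} c b = ≈ᴹ-trans
    (+ᴹ-cong (-‿*ₗ (c zero) (b zero)) (lincomb-neg (tail c) (tail b)))
    (⁻¹-∙-comm _ _)

  lincomb-- : ∀ {d} (c c' : Fin d → F.Carrier) b →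
              lincomb A (λ i → c i F.- c' i) b ≈ᴹ lincomb A c b +ᴹ -ᴹ lincomb A c' b
  lincomb-- c c' b = ≈ᴹ-trans (lincomb-+ c (λ i → F.- c' i) b) (+ᴹ-cong ≈ᴹ-refl (lincomb-neg c' b))

  lincomb-scalars : ∀ {d} (c s : Fin d → F.Carrier) u →
                    lincomb A c (λ k → s k *ₗ u) ≈ᴹ lincomb (selfAct F) c s *ₗ u
  lincomb-scalars {zero}  c s u = ≈ᴹ-sym (*ₗ-zeroˡ u)
  lincomb-scalars {suc d} c s u = ≈ᴹ-trans
    (+ᴹ-cong (≈ᴹ-sym (*ₗ-assoc (c zero) (s zero) u)) (lincomb-scalars (tail c) (tail s) u))
    (≈ᴹ-sym (*ₗ-distribʳ u _ _))

  lincomb-insertAt : ∀ {d} (c : Fin d → F.Carrier) i a (b : Fin (suc d) → Carrierᴹ) →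
                     lincomb A (insertAt c i a) b ≈ᴹ a *ₗ b i +ᴹ lincomb A c (removeAt b i)
  lincomb-insertAt         c zero    a b = ≈ᴹ-refl
  lincomb-insertAt {suc d} c (suc i) a b =
    ≈ᴹ-trans (+ᴹ-cong ≈ᴹ-refl (lincomb-insertAt (tail c) i a (tail b))) (x∙yz≈y∙xz _ _ _)

  lincomb-unitVector : ∀ {d} (b : Fin d → Carrierᴹ) t → lincomb A (unitVector t) b ≈ᴹ b t
  lincomb-unitVector b zero = ≈ᴹ-trans
    (+ᴹ-cong (*ₗ-identityˡ (b zero)) (lincomb-0# (tail b) (λ _ → F.refl))) (+ᴹ-identityʳ _)
  lincomb-unitVector b (suc t) = ≈ᴹ-trans
    (+ᴹ-cong (*ₗ-zeroˡ (b zero)) (lincomb-unitVector (tail b) t)) (+ᴹ-identityˡ _)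

  coefficients-unique : ∀ {d} {b : Fin d → Carrierᴹ} → Independent b →
                        ∀ {c c'} → lincomb A c b ≈ᴹ lincomb A c' b → ∀ i → c i F.≈ c' i
  coefficients-unique {b = b} b-indep {c} {c'} eq i = x∙y⁻¹≈ε⇒x≈y (c i) (c' i)
    (b-indep (λ i → c i F.- c' i) (begin
      lincomb A (λ i → c i F.- c' i) b      ≈⟨ lincomb-- c c' b ⟩
      lincomb A c b +ᴹ -ᴹ lincomb A c' b    ≈⟨ +ᴹ-cong eq ≈ᴹ-refl ⟩
      lincomb A c' b +ᴹ -ᴹ lincomb A c' b   ≈⟨ -ᴹ‿inverseʳ _ ⟩
      0ᴹ                                    ∎) i)
    where open AbelianGroupProperties F.+-abelianGroup using (x∙y⁻¹≈ε⇒x≈y)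

  span-resp : ∀ {d} {b : Fin d → Carrierᴹ} {u v} → u ≈ᴹ v → Span b u → Span b v
  span-resp u≈v (c , u≈bc) = c , ≈ᴹ-trans (≈ᴹ-sym u≈v) u≈bc

  span-generator : ∀ {d} (b : Fin d → Carrierᴹ) t → Span b (b t)
  span-generator b t = unitVector t , ≈ᴹ-sym (lincomb-unitVector b t)

  span-0ᴹ : ∀ {d} (b : Fin d → Carrierᴹ) → Span b 0ᴹ
  span-0ᴹ b = (λ _ → F.0#) , ≈ᴹ-sym (lincomb-0# b (λ _ → F.refl))

  span-+ᴹ : ∀ {d} {b : Fin d → Carrierᴹ} {u v} → Span b u → Span b v → Span b (u +ᴹ v)
  span-+ᴹ {b = b} (c , u≈bc) (c' , v≈bc') =
    (λ i → c i F.+ c' i) , ≈ᴹ-trans (+ᴹ-cong u≈bc v≈bc') (≈ᴹ-sym (lincomb-+ c c' b))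

  span-*ₗ : ∀ {d} {b : Fin d → Carrierᴹ} a {u} → Span b u → Span b (a *ₗ u)
  span-*ₗ {b = b} a (c , u≈bc) =
    (λ i → a F.* c i) , ≈ᴹ-trans (*ₗ-cong F.refl u≈bc) (≈ᴹ-sym (lincomb-* a c b))

  span-lincomb : ∀ {d e} {b : Fin d → Carrierᴹ} c (v : Fin e → Carrierᴹ) →
                 (∀ t → Span b (v t)) → Span b (lincomb A c v)
  span-lincomb {e = zero}  {b} c v v∈b = span-0ᴹ b
  span-lincomb {e = suc e} c v v∈b =
    span-+ᴹ (span-*ₗ (head c) (v∈b zero)) (span-lincomb (tail c) (tail v) (v∈b ∘ suc))

  span-trans : ∀ {d e} {b : Fin d → Carrierᴹ} {v : Fin e → Carrierᴹ} →
               (∀ t → Span b (v t)) → ∀ {w} → Span v w → Span b w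
  span-trans {v = v} v∈b (c , w≈vc) = span-resp (≈ᴹ-sym w≈vc) (span-lincomb c v v∈b)

  span-tail : ∀ {d} {b : Fin (suc d) → Carrierᴹ} {w} ((c , _) : Span b w) → head c F.≈ F.0# → Span (tail b) w
  span-tail {b = b} {w} (c , w≈bc) c₀≈0 = tail c , (begin
    w                                        ≈⟨ w≈bc ⟩
    head c *ₗ head b +ᴹ lincomb A (tail c) (tail b) ≈⟨ +ᴹ-cong (*ₗ-cong c₀≈0 ≈ᴹ-refl) ≈ᴹ-refl ⟩
    F.0# *ₗ head b +ᴹ lincomb A (tail c) (tail b)   ≈⟨ +ᴹ-cong (*ₗ-zeroˡ (head b)) ≈ᴹ-refl ⟩
    0ᴹ +ᴹ lincomb A (tail c) (tail b)               ≈⟨ +ᴹ-identityˡ _ ⟩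
    lincomb A (tail c) (tail b)                     ∎)

  span-head⁺ : ∀ {d} {b : Fin (suc d) → Carrierᴹ} {w} a →
               Span (tail b) (w +ᴹ -ᴹ (a *ₗ head b)) → Span b w
  span-head⁺ {b = b} {w} a (c , rest) = (a ∷ c) , (begin
    w                                          ≈⟨ +ᴹ-identityʳ w ⟨
    w +ᴹ 0ᴹ                                    ≈⟨ +ᴹ-cong ≈ᴹ-refl (-ᴹ‿inverseˡ (a *ₗ head b)) ⟨
    w +ᴹ (-ᴹ (a *ₗ head b) +ᴹ a *ₗ head b)     ≈⟨ +ᴹ-assoc _ _ _ ⟨
    (w +ᴹ -ᴹ (a *ₗ head b)) +ᴹ a *ₗ head b     ≈⟨ +ᴹ-comm _ _ ⟩
    a *ₗ head b +ᴹ (w +ᴹ -ᴹ (a *ₗ head b))     ≈⟨ +ᴹ-cong ≈ᴹ-refl rest ⟩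
    a *ₗ head b +ᴹ lincomb A c (tail b)        ∎)

  span-head⁻ : ∀ {d} {b : Fin (suc d) → Carrierᴹ} {w} ((c , _) : Span b w) →
               Span (tail b) (w +ᴹ -ᴹ (head c *ₗ head b))
  span-head⁻ {b = b} {w} (c , w≈bc) = tail c , (begin
    w +ᴹ -ᴹ (head c *ₗ head b)                                              ≈⟨ +ᴹ-cong w≈bc ≈ᴹ-refl ⟩
    (head c *ₗ head b +ᴹ lincomb A (tail c) (tail b)) +ᴹ -ᴹ (head c *ₗ head b) ≈⟨ xyx⁻¹≈y _ _ ⟩
    lincomb A (tail c) (tail b)                                             ∎)

  module Coordinates {d} (B : Basis A (Full A) d) where
    open Basis B

    coordinates : Carrierᴹ → Fin d → F.Carrier
    coordinates w = proj₁ (span w tt)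

    coordinates-correct : ∀ w → w ≈ᴹ lincomb A (coordinates w) vec
    coordinates-correct w = proj₂ (span w tt)

    coordinates-unique : ∀ {w} c → w ≈ᴹ lincomb A c vec → ∀ i → coordinates w i F.≈ c i
    coordinates-unique {w} c w≈vc =
      coefficients-unique indep (≈ᴹ-trans (≈ᴹ-sym (coordinates-correct w)) w≈vc)

    coordinates-cong : ∀ {u v} → u ≈ᴹ v → ∀ i → coordinates u i F.≈ coordinates v i
    coordinates-cong {u} {v} u≈v = coordinates-unique _ (≈ᴹ-trans u≈v (coordinates-correct v))

    coordinates-+ : ∀ u v i → coordinates (u +ᴹ v) i F.≈ coordinates u i F.+ coordinates v i
    coordinates-+ u v = coordinates-unique _ (begin
      u +ᴹ v                                                       ≈⟨ +ᴹ-cong (coordinates-correct u) (coordinates-correct v) ⟩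
      lincomb A (coordinates u) vec +ᴹ lincomb A (coordinates v) vec ≈⟨ lincomb-+ _ _ vec ⟨
      lincomb A (λ i → coordinates u i F.+ coordinates v i) vec    ∎)

    coordinates-*ₗ : ∀ a u i → coordinates (a *ₗ u) i F.≈ a F.* coordinates u i
    coordinates-*ₗ a u = coordinates-unique _ (begin
      a *ₗ u                                       ≈⟨ *ₗ-cong F.refl (coordinates-correct u) ⟩
      a *ₗ lincomb A (coordinates u) vec           ≈⟨ lincomb-* a _ vec ⟨
      lincomb A (λ i → a F.* coordinates u i) vec  ∎)

  basis⇒≈ᴹ-dec : Decidable F._≈_ → ∀ {d} → Basis A (Full A) d → Decidable _≈ᴹ_
  basis⇒≈ᴹ-dec _≟_ B u v = map′
    (λ same → begin
      u                              ≈⟨ coordinates-correct u ⟩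
      lincomb A (coordinates u) vec  ≈⟨ lincomb-cong same (λ _ → ≈ᴹ-refl) ⟩
      lincomb A (coordinates v) vec  ≈⟨ coordinates-correct v ⟨
      v                              ∎)
    coordinates-cong
    (all? λ i → coordinates u i ≟ coordinates v i)
    where open Basis B using (vec)
          open Coordinates B

  twist-id : ∀ {d} (B : Basis A (Full A) d) x → twist A B id x ≈ᴹ x
  twist-id B x = ≈ᴹ-sym (proj₂ (Basis.span B x tt))

  GL-id : GL A
  GL-id = record
    { fun    = id
    ; linear = record { cong = id ; +-hom = λ _ _ → ≈ᴹ-refl ; ·-hom = λ _ _ → ≈ᴹ-refl }
    ; inv    = id
    ; invˡ   = λ _ → ≈ᴹ-refl
    ; invʳ   = λ _ → ≈ᴹ-refl
    }

  basisChange : ∀ {d} (B B' : Basis A (Full A) d) →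
                Σ (GL A) λ L → ∀ t → GL.fun L (Basis.vec B t) ≈ᴹ Basis.vec B' t
  basisChange B B' = L , L-on-basis
    where
    module C = Coordinates B

    from : ∀ {d} → Basis A (Full A) d → Basis A (Full A) d → Carrierᴹ → Carrierᴹ
    from B B' w = lincomb A (Coordinates.coordinates B w) (Basis.vec B')

    from-inverse : ∀ {d} (B B' : Basis A (Full A) d) w → from B' B (from B B' w) ≈ᴹ w
    from-inverse B B' w = begin
      lincomb A (Coordinates.coordinates B' (from B B' w)) (Basis.vec B)
        ≈⟨ lincomb-cong (Coordinates.coordinates-unique B' _ ≈ᴹ-refl) (λ _ → ≈ᴹ-refl) ⟩
      lincomb A (Coordinates.coordinates B w) (Basis.vec B)
        ≈⟨ Coordinates.coordinates-correct B w ⟨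
      w ∎

    L : GL A
    L = record
      { fun    = from B B'
      ; linear = record
        { cong  = λ u≈v → lincomb-cong (C.coordinates-cong u≈v) (λ _ → ≈ᴹ-refl)
        ; +-hom = λ u v → ≈ᴹ-trans (lincomb-cong (C.coordinates-+ u v) (λ _ → ≈ᴹ-refl)) (lincomb-+ (C.coordinates u) (C.coordinates v) (Basis.vec B'))
        ; ·-hom = λ a u → ≈ᴹ-trans (lincomb-cong (C.coordinates-*ₗ a u) (λ _ → ≈ᴹ-refl)) (lincomb-* a (C.coordinates u) (Basis.vec B'))
        }
      ; inv    = from B' B
      ; invˡ   = from-inverse B B'
      ; invʳ   = from-inverse B' B
      }

    L-on-basis : ∀ t → from B B' (Basis.vec B t) ≈ᴹ Basis.vec B' t
    L-on-basis t = begin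
      lincomb A (C.coordinates (Basis.vec B t)) (Basis.vec B')
        ≈⟨ lincomb-cong (C.coordinates-unique _ (proj₂ (span-generator (Basis.vec B) t))) (λ _ → ≈ᴹ-refl) ⟩
      lincomb A (unitVector t) (Basis.vec B')
        ≈⟨ lincomb-unitVector (Basis.vec B') t ⟩
      Basis.vec B' t ∎

module LinearMap {F : CommutativeRing 0ℓ 0ℓ} {M N : Module F 0ℓ 0ℓ} {f : Module.Carrierᴹ M → Module.Carrierᴹ N}
                 (f-linear : Linear (modAct M) (modAct N) f) where
  private
    module F = CommutativeRing F
    module M = Module M
  open Module N
  open Linear f-linear public
  open AbelianGroupProperties +ᴹ-abelianGroup using (inverseˡ-unique)

  f-0ᴹ : f M.0ᴹ ≈ᴹ 0ᴹ
  f-0ᴹ = ≈ᴹ-trans (cong (M.≈ᴹ-sym (M.*ₗ-zeroʳ F.0#)))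
                  (≈ᴹ-trans (·-hom F.0# M.0ᴹ) (*ₗ-zeroˡ (f M.0ᴹ)))

  f-lincomb : ∀ {d} c (b : Fin d → M.Carrierᴹ) → f (lincomb (modAct M) c b) ≈ᴹ lincomb (modAct N) c (f ∘ b)
  f-lincomb {zero}  c b = f-0ᴹ
  f-lincomb {suc d} c b = ≈ᴹ-trans (+-hom _ _) (+ᴹ-cong (·-hom (c zero) (b zero)) (f-lincomb (tail c) (tail b)))

  f-difference : ∀ u v → f (u M.+ᴹ M.-ᴹ v) ≈ᴹ f u +ᴹ -ᴹ f v
  f-difference u v = ≈ᴹ-trans (+-hom u (M.-ᴹ v)) (+ᴹ-cong ≈ᴹ-refl f-neg)
    where f-neg : f (M.-ᴹ v) ≈ᴹ -ᴹ f v
          f-neg = inverseˡ-unique (f (M.-ᴹ v)) (f v)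
                    (≈ᴹ-trans (≈ᴹ-sym (+-hom _ _)) (≈ᴹ-trans (cong (M.-ᴹ‿inverseˡ v)) f-0ᴹ))

module FiniteField {F : CommutativeRing 0ℓ 0ℓ} (F-field : IsField F) {q} (F-finite : HasCard F q)
                   (M : Module F 0ℓ 0ℓ) where
  private module F = CommutativeRing F
  open Module M
  open LinearCombinations M
  open AbelianGroupProperties +ᴹ-abelianGroup using (inverseˡ-unique)
  open SetoidReasoning ≈ᴹ-setoid

  _≟_ : Decidable F._≈_
  _≟_ = enumeration⇒≈-dec F F-finite

  private
    inverse : ∀ x → ¬ x F.≈ F.0# → F.Carrier
    inverse x x≉0 = proj₁ (proj₂ F-field x x≉0)

    inverse-*ˡ : ∀ x x≉0 → inverse x x≉0 F.* x F.≈ F.1#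
    inverse-*ˡ x x≉0 = F.trans (F.*-comm _ x) (proj₂ (proj₂ F-field x x≉0))

  independent-∷ : ∀ {d} {b : Fin d → Carrierᴹ} {w} → Independent b → ¬ Span b w → Independent (w ∷ b)
  independent-∷ {b = b} {w} b-indep w∉b c eq with head c ≟ F.0#
  ... | yes c₀≈0 = λ { zero → c₀≈0 ; (suc i) → b-indep (tail c) rest≈0 i }
    where
    rest≈0 : lincomb A (tail c) b ≈ᴹ 0ᴹ
    rest≈0 = begin
      lincomb A (tail c) b                 ≈⟨ +ᴹ-identityˡ _ ⟨
      0ᴹ +ᴹ lincomb A (tail c) b           ≈⟨ +ᴹ-cong (*ₗ-zeroˡ w) ≈ᴹ-refl ⟨
      F.0# *ₗ w +ᴹ lincomb A (tail c) b    ≈⟨ +ᴹ-cong (*ₗ-cong c₀≈0 ≈ᴹ-refl) ≈ᴹ-refl ⟨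
      head c *ₗ w +ᴹ lincomb A (tail c) b  ≈⟨ eq ⟩
      0ᴹ                                   ∎
  ... | no c₀≉0 = ⊥-elim (w∉b ((λ j → F.- (y F.* c (suc j))) , w≈rest))
    where
    y : F.Carrier
    y = inverse (head c) c₀≉0

    R : Carrierᴹ
    R = lincomb A (tail c) b

    w≈rest : w ≈ᴹ lincomb A (λ j → F.- (y F.* c (suc j))) b
    w≈rest = begin
      w                                    ≈⟨ *ₗ-identityˡ w ⟨
      F.1# *ₗ w                            ≈⟨ *ₗ-cong (inverse-*ˡ (head c) c₀≉0) ≈ᴹ-refl ⟨
      (y F.* head c) *ₗ w                  ≈⟨ *ₗ-assoc y (head c) w ⟩
      y *ₗ (head c *ₗ w)                   ≈⟨ *ₗ-cong F.refl (inverseˡ-unique _ R eq) ⟩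
      y *ₗ (-ᴹ R)                          ≈⟨ *ₗ-‿ y R ⟩
      -ᴹ (y *ₗ R)                          ≈⟨ -ᴹ‿cong (lincomb-* y (tail c) b) ⟨
      -ᴹ lincomb A (λ j → y F.* c (suc j)) b ≈⟨ lincomb-neg _ b ⟨
      lincomb A (λ j → F.- (y F.* c (suc j))) b ∎

  span? : Decidable _≈ᴹ_ → ∀ {d} (b : Fin d → Carrierᴹ) w → Dec (Span b w)
  span? _≈?_ {zero} b w with w ≈? 0ᴹ
  ... | yes w≈0 = yes ((λ ()) , w≈0)
  ... | no  w≉0 = no λ (_ , w≈0) → w≉0 w≈0
  span? _≈?_ {suc d} b w with any? (λ i → span? _≈?_ (tail b) (w +ᴹ -ᴹ (proj₁ F-finite i *ₗ head b)))
  ... | yes (i , rest) = yes (span-head⁺ {b = b} _ rest)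
  ... | no none = no λ w∈b →
    let i , eᵢ≈c₀ = proj₂ (proj₂ F-finite) (head (proj₁ w∈b)) in
    none (i , span-resp {b = tail b} (+ᴹ-cong ≈ᴹ-refl (-ᴹ‿cong (*ₗ-cong (F.sym eᵢ≈c₀) ≈ᴹ-refl))) (span-head⁻ {b = b} w∈b))

  module _ (_≈?_ : Decidable _≈ᴹ_) {C : Set} (h : C → Carrierᴹ) {k} (u : Fin k → C) where

    record Extension {N} (candidates : Fin N → C) : Set where
      field
        {size}      : ℕ
        new         : Fin size → C
        independent : Independent (h ∘ (new ++ u))
        spans       : ∀ t → Span (h ∘ (new ++ u)) (h (candidates t))

    extend : Independent (h ∘ u) → ∀ {N} (candidates : Fin N → C) → Extension candidates
    extend u-indep {zero} candidates = record { new = λ () ; independent = u-indep ; spans = λ () }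
    extend u-indep {suc N} candidates
      with E ← extend u-indep (tail candidates)
      with span? _≈?_ (h ∘ (Extension.new E ++ u)) (h (head candidates))
    ... | yes c₀∈E = record
      { new = new ; independent = independent ; spans = λ { zero → c₀∈E ; (suc t) → spans t } }
      where open Extension E
    ... | no c₀∉E = record
      { new         = head candidates ∷ new
      ; independent = independent-∷ independent c₀∉E
      ; spans       = λ { zero    → span-generator grown zero
                        ; (suc t) → span-trans {b = grown} (λ i → span-generator grown (suc i)) (spans t) }
      }
      where
      open Extension E
      grown : Fin (suc size ℕ.+ k) → Carrierᴹ
      grown = h ∘ ((head candidates ∷ new) ++ u)

  private
    -- One Steinitz exchange: the vector v i₀ with a nonzero coefficient on head w is used to
    -- eliminate head w from all the other vᵢ.
    exchange : ∀ {p l} (v : Fin (suc p) → Carrierᴹ) (w : Fin (suc l) → Carrierᴹ) → Independent v →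
               (a : Fin (suc p) → Fin (suc l) → F.Carrier) → (∀ i → v i ≈ᴹ lincomb A (a i) w) →
               ∀ i₀ → ¬ head (a i₀) F.≈ F.0# →
               Σ (Fin p → Carrierᴹ) λ v' → Independent v' × ∀ k → Span (tail w) (v' k)
    exchange {p} v w v-indep a v≈aw i₀ a₀≉0 = v' , v'-indep , v'∈tail-w
      where
      y : F.Carrier
      y = inverse (head (a i₀)) a₀≉0

      t : Fin p → F.Carrier
      t k = head (a (punchIn i₀ k)) F.* y

      v' : Fin p → Carrierᴹ
      v' k = v (punchIn i₀ k) +ᴹ -ᴹ (t k *ₗ v i₀)

      t-cancels : ∀ k → t k F.* head (a i₀) F.≈ head (a (punchIn i₀ k))
      t-cancels k = F.trans (F.*-assoc _ y _)
                      (F.trans (F.*-congˡ (inverse-*ˡ (head (a i₀)) a₀≉0)) (F.*-identityʳ _))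

      v'∈tail-w : ∀ k → Span (tail w) (v' k)
      v'∈tail-w k = (λ j → a (punchIn i₀ k) (suc j) F.- t k F.* a i₀ (suc j)) , (begin
        v (punchIn i₀ k) +ᴹ -ᴹ (t k *ₗ v i₀)
          ≈⟨ +ᴹ-cong (v≈aw (punchIn i₀ k)) (-ᴹ‿cong (*ₗ-cong F.refl (v≈aw i₀))) ⟩
        (a₀ *ₗ head w +ᴹ Rₖ) +ᴹ -ᴹ (t k *ₗ (head (a i₀) *ₗ head w +ᴹ R))
          ≈⟨ +ᴹ-cong ≈ᴹ-refl (-ᴹ‿cong (≈ᴹ-trans (*ₗ-distribˡ (t k) _ R)
               (+ᴹ-cong (≈ᴹ-trans (≈ᴹ-sym (*ₗ-assoc _ _ _)) (*ₗ-cong (t-cancels k) ≈ᴹ-refl)) ≈ᴹ-refl))) ⟩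
        (a₀ *ₗ head w +ᴹ Rₖ) +ᴹ -ᴹ (a₀ *ₗ head w +ᴹ t k *ₗ R)
          ≈⟨ +ᴹ-‿-cancelˡ _ Rₖ _ ⟩
        Rₖ +ᴹ -ᴹ (t k *ₗ R)
          ≈⟨ +ᴹ-cong ≈ᴹ-refl (-ᴹ‿cong (lincomb-* (t k) (tail (a i₀)) (tail w))) ⟨
        Rₖ +ᴹ -ᴹ lincomb A (λ j → t k F.* a i₀ (suc j)) (tail w)
          ≈⟨ lincomb-- (tail (a (punchIn i₀ k))) _ (tail w) ⟨
        lincomb A (λ j → a (punchIn i₀ k) (suc j) F.- t k F.* a i₀ (suc j)) (tail w) ∎)
        where
        a₀ : F.Carrier
        a₀ = head (a (punchIn i₀ k))

        Rₖ R : Carrierᴹ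
        Rₖ = lincomb A (tail (a (punchIn i₀ k))) (tail w)
        R  = lincomb A (tail (a i₀)) (tail w)

      v'-indep : Independent v'
      v'-indep c' v'c'≈0 k =
        ≡.subst (F._≈ F.0#) (insertAt-punchIn c' i₀ α k) (v-indep c vc≈0 (punchIn i₀ k))
        where
        α : F.Carrier
        α = lincomb (selfAct F) c' (λ k → F.- t k)

        c : Fin (suc p) → F.Carrier
        c = insertAt c' i₀ α

        vc≈0 : lincomb A c v ≈ᴹ 0ᴹ
        vc≈0 = begin
          lincomb A c v                                                     ≈⟨ lincomb-insertAt c' i₀ α v ⟩
          α *ₗ v i₀ +ᴹ lincomb A c' (removeAt v i₀)                         ≈⟨ +ᴹ-comm _ _ ⟩
          lincomb A c' (removeAt v i₀) +ᴹ α *ₗ v i₀                         ≈⟨ +ᴹ-cong ≈ᴹ-refl (lincomb-scalars c' _ (v i₀)) ⟨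
          lincomb A c' (removeAt v i₀) +ᴹ lincomb A c' (λ k → (F.- t k) *ₗ v i₀)
            ≈⟨ +ᴹ-cong ≈ᴹ-refl (lincomb-cong (λ _ → F.refl) (λ k → -‿*ₗ (t k) (v i₀))) ⟩
          lincomb A c' (removeAt v i₀) +ᴹ lincomb A c' (λ k → -ᴹ (t k *ₗ v i₀)) ≈⟨ lincomb-+ᴹ c' _ _ ⟨
          lincomb A c' v'                                                   ≈⟨ v'c'≈0 ⟩
          0ᴹ                                                                ∎

  independent≤spanning : ∀ {p l} {v : Fin p → Carrierᴹ} {w : Fin l → Carrierᴹ} →
                         Independent v → (∀ i → Span w (v i)) → p ≤ l
  independent≤spanning {zero} _ _ = z≤n
  independent≤spanning {suc p} {zero} {v} v-indep v∈w =
    ⊥-elim (proj₁ F-field (v-indep (unitVector zero) v₀≈0 zero))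
    where v₀≈0 : lincomb A (unitVector zero) v ≈ᴹ 0ᴹ
          v₀≈0 = ≈ᴹ-trans (lincomb-unitVector v zero) (proj₂ (v∈w zero))
  independent≤spanning {suc p} {suc l} {v} {w} v-indep v∈w
    with any? (λ i → ¬? (head (proj₁ (v∈w i)) ≟ F.0#))
  ... | yes (i₀ , a₀≉0) =
    let v' , v'-indep , v'∈tail-w = exchange v w v-indep (proj₁ ∘ v∈w) (proj₂ ∘ v∈w) i₀ a₀≉0
    in s≤s (independent≤spanning v'-indep v'∈tail-w)
  ... | no none = ℕ.m≤n⇒m≤1+n (independent≤spanning v-indep λ i →
    span-tail {b = w} (v∈w i) (decidable-stable (head (proj₁ (v∈w i)) ≟ F.0#) λ a₀≉0 → none (i , a₀≉0)))

  basis-length-unique : ∀ {d d'} → Basis A (Full A) d → Basis A (Full A) d' → d ≡ d'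
  basis-length-unique B B' = ℕ.≤-antisym
    (independent≤spanning (Basis.indep B) (λ i → Basis.span B' (Basis.vec B i) tt))
    (independent≤spanning (Basis.indep B') (λ i → Basis.span B (Basis.vec B' i) tt))

  finite⇒basis : Decidable _≈ᴹ_ → ∀ {N} (e : Fin N → Carrierᴹ) → (∀ v → ∃[ i ] e i ≈ᴹ v) →
                 ∃[ d ] Basis A (Full A) d
  finite⇒basis _≈?_ e e-surjective = size ℕ.+ 0 , record
    { vec   = new ++ λ ()
    ; inS   = λ _ → tt
    ; indep = independent
    ; span  = λ v _ → let i , eᵢ≈v = e-surjective v in span-resp eᵢ≈v (spans i)
    }
    where open Extension (extend _≈?_ id {k = 0} (λ ()) (λ _ _ ()) e)

  record BasisExtending {k} (u : Fin k → Carrierᴹ) : Set where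
    field
      {extra} : ℕ
      basis   : Basis A (Full A) (extra ℕ.+ k)
      extends : ∀ i → Basis.vec basis (extra ↑ʳ i) ≡ u i

  extendToBasis : ∀ {m} → Basis A (Full A) m → ∀ {k} {u : Fin k → Carrierᴹ} → Independent u → BasisExtending u
  extendToBasis B {u = u} u-indep = record
    { basis   = record
      { vec   = new ++ u
      ; inS   = λ _ → tt
      ; indep = independent
      ; span  = λ w _ → span-trans spans (Basis.span B w tt)
      }
    ; extends = ++-↑ʳ new u
    }
    where open Extension (extend (basis⇒≈ᴹ-dec _≟_ B) id u u-indep (Basis.vec B))

  independent⇒GL-related : ∀ {m} → Basis A (Full A) m → ∀ {k} {u ū : Fin k → Carrierᴹ} →
                           Independent u → Independent ū → Σ (GL A) λ L → ∀ i → GL.fun L (u i) ≈ᴹ ū i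
  independent⇒GL-related B {k} {u} {ū} u-indep ū-indep = relate E.basis Ē.basis
    (ℕ.+-cancelʳ-≡ k E.extra Ē.extra (basis-length-unique E.basis Ē.basis)) E.extends Ē.extends
    where
    module E = BasisExtending (extendToBasis B u-indep)
    module Ē = BasisExtending (extendToBasis B ū-indep)

    relate : ∀ {j j'} (E : Basis A (Full A) (j ℕ.+ k)) (Ē : Basis A (Full A) (j' ℕ.+ k)) → j ≡ j' →
             (∀ i → Basis.vec E (j ↑ʳ i) ≡ u i) → (∀ i → Basis.vec Ē (j' ↑ʳ i) ≡ ū i) →
             Σ (GL A) λ L → ∀ i → GL.fun L (u i) ≈ᴹ ū i
    relate {j} E Ē ≡.refl E-extends Ē-extends = L , λ i → begin
      GL.fun L (u i)                  ≈⟨ Linear.cong (GL.linear L) (≈ᴹ-reflexive (E-extends i)) ⟨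
      GL.fun L (Basis.vec E (j ↑ʳ i)) ≈⟨ L-on-basis (j ↑ʳ i) ⟩
      Basis.vec Ē (j ↑ʳ i)            ≡⟨ Ē-extends i ⟩
      ū i                             ∎
      where open Σ (basisChange E Ē) renaming (proj₁ to L; proj₂ to L-on-basis)

module _ {F : CommutativeRing 0ℓ 0ℓ} {V W : Module F 0ℓ 0ℓ} {G Ḡ : Module.Carrierᴹ V → Module.Carrierᴹ W}
         (G-linear : Linear (modAct V) (modAct W) G) (Ḡ-linear : Linear (modAct V) (modAct W) Ḡ) where
  private
    module V = Module V
    module G = LinearMap {M = V} {N = W} G-linear
    module Ḡ = LinearMap {M = V} {N = W} Ḡ-linear
  open Module W
  open LinearCombinations W
  open AbelianGroupProperties +ᴹ-abelianGroup using (x∙y⁻¹≈ε⇒x≈y)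
  open SetoidReasoning ≈ᴹ-setoid

  kernel⊆⇒coefficients-transfer : (∀ v → G v ≈ᴹ 0ᴹ → Ḡ v ≈ᴹ 0ᴹ) → ∀ {d} (x : Fin d → V.Carrierᴹ) {v} c →
                                  G v ≈ᴹ lincomb A c (G ∘ x) → Ḡ v ≈ᴹ lincomb A c (Ḡ ∘ x)
  kernel⊆⇒coefficients-transfer ker⊆ x {v} c Gv≈Gxc = x∙y⁻¹≈ε⇒x≈y _ _ (begin
    Ḡ v +ᴹ -ᴹ lincomb A c (Ḡ ∘ x)                 ≈⟨ +ᴹ-cong ≈ᴹ-refl (-ᴹ‿cong (Ḡ.f-lincomb c x)) ⟨
    Ḡ v +ᴹ -ᴹ Ḡ (lincomb (modAct V) c x)          ≈⟨ Ḡ.f-difference v _ ⟨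
    Ḡ (v V.+ᴹ V.-ᴹ lincomb (modAct V) c x)        ≈⟨ ker⊆ _ G-difference≈0 ⟩
    0ᴹ                                            ∎)
    where
    G-difference≈0 : G (v V.+ᴹ V.-ᴹ lincomb (modAct V) c x) ≈ᴹ 0ᴹ
    G-difference≈0 = begin
      G (v V.+ᴹ V.-ᴹ lincomb (modAct V) c x) ≈⟨ G.f-difference v _ ⟩
      G v +ᴹ -ᴹ G (lincomb (modAct V) c x)   ≈⟨ +ᴹ-cong Gv≈Gxc (-ᴹ‿cong (G.f-lincomb c x)) ⟩
      lincomb A c (G ∘ x) +ᴹ -ᴹ lincomb A c (G ∘ x) ≈⟨ -ᴹ‿inverseʳ _ ⟩
      0ᴹ                                     ∎

  same-kernel⇒GL-related : IsField F → ∀ {q} → HasCard F q →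
                          ∀ {N} (s : Fin N → V.Carrierᴹ) → (∀ v → LinearCombinations.Span V s v) →
                          ∀ {m} → Basis A (Full A) m → (∀ v → G v ≈ᴹ 0ᴹ ⇔ Ḡ v ≈ᴹ 0ᴹ) →
                          Σ (GL A) λ L → ∀ v → GL.fun L (G v) ≈ᴹ Ḡ v
  same-kernel⇒GL-related F-field F-finite s s-spans B sameKernel = L , λ v →
    let a , Gv≈Gxa = Gv∈span v in begin
    GL.fun L (G v)                   ≈⟨ L.cong Gv≈Gxa ⟩
    GL.fun L (lincomb A a (G ∘ x))   ≈⟨ L.f-lincomb a (G ∘ x) ⟩
    lincomb A a (GL.fun L ∘ G ∘ x)   ≈⟨ lincomb-cong (λ _ → CommutativeRing.refl F) L-relates ⟩
    lincomb A a (Ḡ ∘ x)              ≈⟨ kernel⊆⇒coefficients-transfer (Equivalence.to ∘ sameKernel) x a Gv≈Gxa ⟨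
    Ḡ v                              ∎
    where
    open FiniteField F-field F-finite W using (_≟_; extend; Extension; independent⇒GL-related)
    open Extension (extend (basis⇒≈ᴹ-dec _≟_ B) G {k = 0} (λ ()) (λ _ _ ()) s)

    x : Fin (size ℕ.+ 0) → V.Carrierᴹ
    x = new ++ λ ()

    Gv∈span : ∀ v → Span (G ∘ x) (G v)
    Gv∈span v = let c , v≈sc = s-spans v in span-resp
      (≈ᴹ-sym (≈ᴹ-trans (G.cong v≈sc) (G.f-lincomb c s))) (span-lincomb c (G ∘ s) spans)

    Ḡx-independent : Independent (Ḡ ∘ x)
    Ḡx-independent c Ḡxc≈0 = independent c (≈ᴹ-trans (≈ᴹ-sym (G.f-lincomb c x))
      (Equivalence.from (sameKernel _) (≈ᴹ-trans (Ḡ.f-lincomb c x) Ḡxc≈0)))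

    L : GL A
    L = proj₁ (independent⇒GL-related B independent Ḡx-independent)

    L-relates : ∀ i → GL.fun L (G (x i)) ≈ᴹ Ḡ (x i)
    L-relates = proj₂ (independent⇒GL-related B independent Ḡx-independent)

    module L = LinearMap {M = W} {N = W} (GL.linear L)

restrictScalars-finitelySpanned :
  {F K : CommutativeRing 0ℓ 0ℓ} (ι : CommutativeRing.Carrier F → CommutativeRing.Carrier K)
  (ι-hom : IsRingHom F K ι) (V : Module K 0ℓ 0ℓ) → ∀ {N} → HasCard K N →
  ∀ {r} → Basis (modAct V) (Full (modAct V)) r →
  Σ (Fin (r * N) → Module.Carrierᴹ V) λ s → ∀ v → LinearCombinations.Span (restrictScalars {F} ι ι-hom V) s v
restrictScalars-finitelySpanned {F} ι ι-hom V {N} (e , _ , e-surjective) {r} B = s , s-spans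
  where
  open Module V
  open LinearCombinations (restrictScalars {F} ι ι-hom V)
  open Basis B

  s : Fin (r * N) → Carrierᴹ
  s t = e (proj₂ (remQuot {r} N t)) *ₗ vec (proj₁ (remQuot {r} N t))

  multiple∈span : ∀ j μ → Span s (μ *ₗ vec j)
  multiple∈span j μ = span-resp (*ₗ-cong eᵢ≈μ ≈ᴹ-refl)
    (≡.subst (Span s) (≡.cong (λ (j , i) → e i *ₗ vec j) (remQuot-combine {r} {N} j i)) (span-generator s (combine {r} {N} j i)))
    where open Σ (e-surjective μ) renaming (proj₁ to i; proj₂ to eᵢ≈μ)

  lincomb∈span : ∀ {d} c (b : Fin d → Carrierᴹ) → (∀ j μ → Span s (μ *ₗ b j)) → Span s (lincomb (modAct V) c b)
  lincomb∈span {zero}  c b _   = span-0ᴹ s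
  lincomb∈span {suc d} c b b∈s = span-+ᴹ (b∈s zero (head c)) (lincomb∈span (tail c) (tail b) (b∈s ∘ suc))

  s-spans : ∀ v → Span s v
  s-spans v = span-resp (≈ᴹ-sym (proj₂ (span v tt))) (lincomb∈span _ vec multiple∈span)

GL-related⇒codes-equivalent :
  {F K : CommutativeRing 0ℓ 0ℓ} (ι : CommutativeRing.Carrier F → CommutativeRing.Carrier K) (ι-hom : IsRingHom F K ι)
  (V : Module K 0ℓ 0ℓ) (W : Module F 0ℓ 0ℓ) {G Ḡ : Module.Carrierᴹ V → Module.Carrierᴹ W} →
  Linear (restrict {F} {K} ι (modAct V)) (modAct W) G →
  ∀ {dK} → Basis (restrict {F} {K} ι (selfAct K)) (Full (restrict {F} {K} ι (selfAct K))) dK →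
  ∀ {m} → Basis (modAct W) (Full (modAct W)) m →
  (L : GL (modAct W)) → (∀ v → Module._≈ᴹ_ W (GL.fun L (G v)) (Ḡ v)) →
  Equivalent (restrict {F} {K} ι (selfAct K)) (modAct W) (CodeSet V W G) (CodeSet V W Ḡ)
GL-related⇒codes-equivalent {F} {K} ι ι-hom V W {G} {Ḡ} G-linear {dK} B-K {m} B-W L L-relates =
  dK , B-K , m , B-W , Aut-id , L , LinearCombinations.GL-id Kᶠ , λ g → to g , from g
  where
  module V = Module V
  open Module W
  open SetoidReasoning ≈ᴹ-setoid
  module L = Linear (GL.linear L)
  module G = Linear G-linear

  Kᶠ : Module F 0ℓ 0ℓ
  Kᶠ = restrictScalars ι ι-hom (⟨module⟩ {R = K})

  Aut-id : Aut F
  Aut-id = record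
    { ρ = id ; ρ⁻¹ = id ; isHom = isRingHomomorphism (CommutativeRing.rawRing F) (CommutativeRing.refl F)
    ; invˡ = λ _ → CommutativeRing.refl F ; invʳ = λ _ → CommutativeRing.refl F }

  image : (CommutativeRing.Carrier K → Carrierᴹ) → CommutativeRing.Carrier K → Carrierᴹ
  image f μ = GL.fun L (twist (modAct W) B-W id (f (twist (modAct Kᶠ) B-K id μ)))

  Represented : (CommutativeRing.Carrier K → Carrierᴹ) → Set
  Represented g = ∃[ f ] (CodeSet V W G f × ∀ μ → g μ ≈ᴹ image f μ)

  image-orbit : ∀ v μ → image (λ μ → G (μ V.*ₗ v)) μ ≈ᴹ Ḡ (μ V.*ₗ v)
  image-orbit v μ = begin
    GL.fun L (twist (modAct W) B-W id (G (twist (modAct Kᶠ) B-K id μ V.*ₗ v)))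
      ≈⟨ L.cong (LinearCombinations.twist-id W B-W _) ⟩
    GL.fun L (G (twist (modAct Kᶠ) B-K id μ V.*ₗ v))
      ≈⟨ L.cong (G.cong (V.*ₗ-cong (LinearCombinations.twist-id Kᶠ B-K μ) V.≈ᴹ-refl)) ⟩
    GL.fun L (G (μ V.*ₗ v))
      ≈⟨ L-relates (μ V.*ₗ v) ⟩
    Ḡ (μ V.*ₗ v) ∎

  to : ∀ g → CodeSet V W Ḡ g → Represented g
  to g (v , g≈Ḡτᵥ) = (λ μ → G (μ V.*ₗ v)) , (v , λ _ → ≈ᴹ-refl) , λ μ →
    ≈ᴹ-trans (g≈Ḡτᵥ μ) (≈ᴹ-sym (image-orbit v μ))

  from : ∀ g → Represented g → CodeSet V W Ḡ g
  from g (f , (v , f≈Gτᵥ) , g≈image) = v , λ μ → begin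
    g μ                                                      ≈⟨ g≈image μ ⟩
    GL.fun L (twist (modAct W) B-W id (f (twist (modAct Kᶠ) B-K id μ)))
      ≈⟨ L.cong (LinearCombinations.twist-id W B-W _) ⟩
    GL.fun L (f (twist (modAct Kᶠ) B-K id μ))                ≈⟨ L.cong (f≈Gτᵥ _) ⟩
    GL.fun L (G (twist (modAct Kᶠ) B-K id μ V.*ₗ v))
      ≈⟨ L.cong (LinearCombinations.twist-id W B-W _) ⟨
    image (λ μ → G (μ V.*ₗ v)) μ                             ≈⟨ image-orbit v μ ⟩
    Ḡ (μ V.*ₗ v)                                             ∎

proposition3p4 :
    (q : ℕ) → PrimePower q →
    (r n m : ℕ) → 1 ≤ r → 1 ≤ n → r * n ≡ 2 * m →
    (Fq : CommutativeRing 0ℓ 0ℓ) → IsField Fq → HasCard Fq q →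
    (K : CommutativeRing 0ℓ 0ℓ) → IsField K → HasCard K (q ^ n) →
    (ι : CommutativeRing.Carrier Fq → CommutativeRing.Carrier K) → IsRingHom Fq K ι →
    (V : Module K 0ℓ 0ℓ) → HasDim (modAct V) (Full (modAct V)) r →
    (U : Module.Carrierᴹ V → Set) →
    Subspace (restrict {Fq} {K} ι (modAct V)) U →
    HasDim (restrict {Fq} {K} ι (modAct V)) U m →
    (∀ v d → HasDim (restrict {Fq} {K} ι (modAct V))
                    (λ w → U w × ∃[ μ ] (Module._≈ᴹ_ V w (Module._*ₗ_ V μ v))) d → d < n) →
    (W : Module Fq 0ℓ 0ℓ) → HasDim (modAct W) (Full (modAct W)) m →
    (G G̅ : Module.Carrierᴹ V → Module.Carrierᴹ W) →
    Linear (restrict {Fq} {K} ι (modAct V)) (modAct W) G →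
    Linear (restrict {Fq} {K} ι (modAct V)) (modAct W) G̅ →
    (∀ v → Module._≈ᴹ_ W (G v) (Module.0ᴹ W) ⇔ U v) →
    (∀ v → Module._≈ᴹ_ W (G̅ v) (Module.0ᴹ W) ⇔ U v) →
    Equivalent (restrict {Fq} {K} ι (selfAct K)) (modAct W) (CodeSet V W G) (CodeSet V W G̅)
proposition3p4 _ _ _ _ _ _ _ _ Fq Fq-field Fq-finite K _ K-finite ι ι-hom V V-basis _ _ _ _
               W W-basis G G̅ G-linear G̅-linear G-kernel G̅-kernel =
  let _ , K-basis = FiniteField.finite⇒basis Fq-field Fq-finite (restrictScalars ι ι-hom (⟨module⟩ {R = K}))
                      (enumeration⇒≈-dec K K-finite) (proj₁ K-finite) (proj₂ (proj₂ K-finite))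
      s , s-spans = restrictScalars-finitelySpanned {Fq} ι ι-hom V K-finite V-basis
      L , L-relates = same-kernel⇒GL-related {V = restrictScalars ι ι-hom V} {W = W} G-linear G̅-linear
                        Fq-field Fq-finite s s-spans W-basis
                        (λ v → ⇔.trans (G-kernel v) (⇔.sym (G̅-kernel v)))
  in GL-related⇒codes-equivalent ι ι-hom V W G-linear K-basis W-basis L L-relates
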